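{- Let $\mathsf{P} : \mathsf{E} \rightarrow \mathsf{B}$ be an order-enriched fibration. If $g = \langle \check{g}, \hat{g} \rangle : A_0 \rightleftharpoons A_1$ is an $\mathsf{E}$-reflection, then its right adjoint $\hat{g} : A_1 \rightarrow A_0$ is a cartesian $\mathsf{E}$-morphism. If $g = \langle \check{g}, \hat{g} \rangle : A_0 \rightleftharpoons A_1$ is an $\mathsf{E}$-coreflection, then its left adjoint $\check{g} : A_0 \rightarrow A_1$ is a cartesian $\mathsf{E}$-morphism.
   Context: All composition is written in diagrammatic order: $f \cdot g$ means first $f$, then $g$. An order-enriched category is a category whose hom-sets are preorders with composition monotone in each argument; $f \equiv g$ means $f \leq g$ and $g \leq f$. An order-enriched functor is a functor that is monotone on hom-preorders. In an order-enriched category, an adjunction $g = \langle \check{g}, \hat{g} \rangle : A \rightleftharpoons B$ consists of morphisms $\check{g} : A \rightarrow B$ (left adjoint) and $\hat{g} : B \rightarrow A$ (right adjoint) with $1_A \leq \check{g} \cdot \hat{g}$ and $\hat{g} \cdot \check{g} \leq 1_B$. It is a reflection if moreover $\hat{g} \cdot \check{g} = 1_B$, and a coreflection if moreover $\check{g} \cdot \hat{g} = 1_A$. For a functor $\mathsf{P} : \mathsf{E} \rightarrow \mathsf{B}$: a fiber pair $(b,E_1)$ is a $\mathsf{B}$-morphism $b : B_2 \rightarrow B_1$ with an $\mathsf{E}$-object $E_1$, $\mathsf{P}(E_1) = B_1$. An $\mathsf{E}$-morphism $e : E_2 \rightarrow E_1$ is cartesian (for $(\mathsf{P}(e),E_1)$)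 if for every $\mathsf{E}$-morphism $v : E \rightarrow E_1$ and every $\mathsf{B}$-morphism $x : \mathsf{P}(E) \rightarrow \mathsf{P}(E_2)$ with $x \cdot \mathsf{P}(e) = \mathsf{P}(v)$ there is a unique $u : E \rightarrow E_2$ with $u \cdot e = v$ and $\mathsf{P}(u) = x$. $\mathsf{P}$ is a fibration if every fiber pair has a cartesian morphism over it; a splitting is a choice $\gamma(b,E_1)$ of such morphisms with $\gamma(1_B,E) = 1_E$ and $\gamma(b_2 \cdot b_1,E_1) = \gamma(b_2,E_2)\cdot\gamma(b_1,E_1)$ ($E_2$ the source of $\gamma(b_1,E_1)$). For $e : E_2 \rightarrow E_1$: lift $\sharp_e = \gamma(\mathsf{P}(e),E_1) : \Delta(e) \rightarrow E_1$, apex $\Delta(e)$, gap the unique $\flat_e : E_2 \rightarrow \Delta(e)$ with $\mathsf{P}(\flat_e)$ an identity and $e = \flat_e \cdot \sharp_e$. An order-enriched fibration is an order-enriched functor $\mathsf{P} : \mathsf{E} \rightarrow \mathsf{B}$ that is a split fibration such that: (i) $\mathsf{P}$ is faithful, replete and preserves limits; (ii) if $e : E_2 \rightarrow E_1$ is cartesian then $\Delta(e) = E_2$, $\flat_e = 1_{E_2}$, $\sharp_e = e$; (iii) for cartesian $e : E_2 \rightarrow E_1$ and parallel $g,h : E_3 \rightarrow E_2$, $g \cdot e \leq h \cdot e$ implies $g \leq h$; (iv) for any $e$ and parallel $g,h : \Delta(e) \rightarrow E$, $\flat_e \cdot g \leq \flat_e \cdot h$ implies $g \leq h$; (v) if $f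 \equiv g : E_2 \rightarrow E_1$ then $\Delta(f) = \Delta(g)$, $\flat_f = \flat_g$ and $\sharp_f \equiv \sharp_g$. -}

module Defs where

open import Level using (Level; _⊔_) renaming (suc to lsuc)
open import Data.Product using (Σ; _×_; _,_)
open import Relation.Binary.PropositionalEquality using (_≡_; subst)

-- Equality of morphisms whose endpoints are only propositionally equal:
-- equality of the triples (source , target , morphism).

ArrEq : ∀ {o h} {O : Set o} (H : O → O → Set h) {A B A' B' : O} →
        H A B → H A' B' → Set (o ⊔ h)
ArrEq {O = O} H {A} {B} {A'} {B'} f g =
  _≡_ {A = Σ O (λ X → Σ O (λ Y → H X Y))} (A , B , f) (A' , B' , g)

-- Ordinary categories (used as shapes of diagrams). Composition is
-- diagrammatic: f · g = first f, then g.

record Category (o h : Level) : Set (lsuc (o ⊔ h)) where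
  infixr 9 _·_
  field
    Obj   : Set o
    Hom   : Obj → Obj → Set h
    id    : ∀ {A} → Hom A A
    _·_   : ∀ {A B C} → Hom A B → Hom B C → Hom A C
    idˡ   : ∀ {A B} (f : Hom A B) → id · f ≡ f
    idʳ   : ∀ {A B} (f : Hom A B) → f · id ≡ f
    assoc : ∀ {A B C D} (f : Hom A B) (g : Hom B C) (k : Hom C D) →
            (f · g) · k ≡ f · (g · k)

record OrderCat (o h r : Level) : Set (lsuc (o ⊔ h ⊔ r)) where
  infixr 9 _·_
  infix 4 _≤_ _≣_
  field
    Obj    : Set o
    Hom    : Obj → Obj → Set h
    _≤_    : ∀ {A B} → Hom A B → Hom A B → Set r
    id     : ∀ {A} → Hom A A
    _·_    : ∀ {A B C} → Hom A B → Hom B C → Hom A C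
    idˡ    : ∀ {A B} (f : Hom A B) → id · f ≡ f
    idʳ    : ∀ {A B} (f : Hom A B) → f · id ≡ f
    assoc  : ∀ {A B C D} (f : Hom A B) (g : Hom B C) (k : Hom C D) →
             (f · g) · k ≡ f · (g · k)
    ≤-refl  : ∀ {A B} {f : Hom A B} → f ≤ f
    ≤-trans : ∀ {A B} {f g k : Hom A B} → f ≤ g → g ≤ k → f ≤ k
    ·-monoˡ : ∀ {A B C} {f f' : Hom A B} (g : Hom B C) → f ≤ f' → f · g ≤ f' · g
    ·-monoʳ : ∀ {A B C} (f : Hom A B) {g g' : Hom B C} → g ≤ g' → f · g ≤ f · g'

  -- f ≡ g in the paper's notation: f ≤ g and g ≤ f
  _≣_ : ∀ {A B} → Hom A B → Hom A B → Set r
  f ≣ g = (f ≤ g) × (g ≤ f)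

  IsIso : ∀ {A B} → Hom A B → Set h
  IsIso {A} {B} f = Σ (Hom B A) (λ g → (f · g ≡ id) × (g · f ≡ id))

  record Adjunction (A B : Obj) : Set (h ⊔ r) where
    field
      left  : Hom A B
      right : Hom B A
      unit   : id ≤ left · right
      counit : right · left ≤ id

  IsReflection : ∀ {A B} → Adjunction A B → Set h
  IsReflection g = Adjunction.right g · Adjunction.left g ≡ id

  IsCoreflection : ∀ {A B} → Adjunction A B → Set h
  IsCoreflection g = Adjunction.left g · Adjunction.right g ≡ id

  ArrEqC : ∀ {A B A' B'} → Hom A B → Hom A' B' → Set (o ⊔ h)
  ArrEqC = ArrEq Hom

module _ {jo jh o h r : Level} (J : Category jo jh) (C : OrderCat o h r) where
  private
    module J = Category J
    module C = OrderCat C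

  record Diagram : Set (jo ⊔ jh ⊔ o ⊔ h) where
    field
      D₀    : J.Obj → C.Obj
      D₁    : ∀ {i j} → J.Hom i j → C.Hom (D₀ i) (D₀ j)
      D-id  : ∀ {i} → D₁ (J.id {i}) ≡ C.id
      D-comp : ∀ {i j k} (f : J.Hom i j) (g : J.Hom j k) →
               D₁ (f J.· g) ≡ D₁ f C.· D₁ g

  record Cone (D : Diagram) : Set (jo ⊔ jh ⊔ o ⊔ h) where
    open Diagram D
    field
      apex    : C.Obj
      leg     : ∀ j → C.Hom apex (D₀ j)
      commute : ∀ {i j} (f : J.Hom i j) → leg i C.· D₁ f ≡ leg j

  IsLimit : {D : Diagram} → Cone D → Set (jo ⊔ jh ⊔ o ⊔ h)
  IsLimit {D} c = ∀ (c' : Cone D) →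
    Σ (C.Hom (Cone.apex c') (Cone.apex c)) λ u →
      (∀ j → u C.· Cone.leg c j ≡ Cone.leg c' j) ×
      (∀ (u' : C.Hom (Cone.apex c') (Cone.apex c)) →
         (∀ j → u' C.· Cone.leg c j ≡ Cone.leg c' j) → u' ≡ u)

record OEFunctor {o h r o' h' r' : Level}
                 (E : OrderCat o h r) (B : OrderCat o' h' r')
                 : Set (o ⊔ h ⊔ r ⊔ o' ⊔ h' ⊔ r') where
  private
    module E = OrderCat E
    module B = OrderCat B
  field
    F₀     : E.Obj → B.Obj
    F₁     : ∀ {X Y} → E.Hom X Y → B.Hom (F₀ X) (F₀ Y)
    F-id   : ∀ {X} → F₁ (E.id {X}) ≡ B.id
    F-comp : ∀ {X Y Z} (f : E.Hom X Y) (g : E.Hom Y Z) →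
             F₁ (f E.· g) ≡ F₁ f B.· F₁ g
    F-mono : ∀ {X Y} {f g : E.Hom X Y} → f E.≤ g → F₁ f B.≤ F₁ g

module _ {o h r o' h' r' : Level} {E : OrderCat o h r} {B : OrderCat o' h' r'}
         (P : OEFunctor E B) where
  private
    module E = OrderCat E
    module B = OrderCat B
  open OEFunctor P

  IsCartesian : ∀ {E₂ E₁} → E.Hom E₂ E₁ → Set (o ⊔ h ⊔ h')
  IsCartesian {E₂} {E₁} e =
    ∀ {X} (v : E.Hom X E₁) (x : B.Hom (F₀ X) (F₀ E₂)) →
      x B.· F₁ e ≡ F₁ v →
      Σ (E.Hom X E₂) λ u → ((u E.· e ≡ v) × (F₁ u ≡ x)) ×
        (∀ (u' : E.Hom X E₂) → (u' E.· e ≡ v) × (F₁ u' ≡ x) → u' ≡ u)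

  Faithful : Set (o ⊔ h ⊔ h')
  Faithful = ∀ {X Y} (f g : E.Hom X Y) → F₁ f ≡ F₁ g → f ≡ g

  Replete : Set (o ⊔ h ⊔ o' ⊔ h')
  Replete = ∀ {Y : B.Obj} {X : E.Obj} (b : B.Hom Y (F₀ X)) → B.IsIso b →
    Σ E.Obj λ X' → Σ (E.Hom X' X) λ e → E.IsIso e × ArrEq B.Hom (F₁ e) b

  mapDiagram : ∀ {jo jh} {J : Category jo jh} → Diagram J E → Diagram J B
  mapDiagram D = record
    { D₀ = λ j → F₀ (D₀ j) ; D₁ = λ f → F₁ (D₁ f)
    ; D-id = Relation.Binary.PropositionalEquality.trans
               (Relation.Binary.PropositionalEquality.cong F₁ D-id) F-id
    ; D-comp = λ f g → Relation.Binary.PropositionalEquality.trans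
               (Relation.Binary.PropositionalEquality.cong F₁ (D-comp f g))
               (F-comp (D₁ f) (D₁ g)) }
    where open Diagram D

  mapCone : ∀ {jo jh} {J : Category jo jh} {D : Diagram J E} →
            Cone J E D → Cone J B (mapDiagram D)
  mapCone c = record
    { apex = F₀ apex ; leg = λ j → F₁ (leg j)
    ; commute = λ f → Relation.Binary.PropositionalEquality.trans
        (Relation.Binary.PropositionalEquality.sym (F-comp _ _))
        (Relation.Binary.PropositionalEquality.cong F₁ (commute f)) }
    where open Cone c

  PreservesLimits : (jo jh : Level) → Set (lsuc (jo ⊔ jh) ⊔ o ⊔ h ⊔ o' ⊔ h')
  PreservesLimits jo jh = ∀ (J : Category jo jh) (D : Diagram J E)
    (c : Cone J E D) → IsLimit J E c → IsLimit J B (mapCone c)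

-- Order-enriched fibrations (with a chosen splitting γ)

record OEFibration {o h r o' h' r' : Level} (jo jh : Level)
                   (E : OrderCat o h r) (B : OrderCat o' h' r')
                   : Set (lsuc (jo ⊔ jh) ⊔ o ⊔ h ⊔ r ⊔ o' ⊔ h' ⊔ r') where
  private
    module E = OrderCat E
    module B = OrderCat B
  field
    P : OEFunctor E B
  open OEFunctor P
  field
    liftObj   : ∀ {B₂} (E₁ : E.Obj) (b : B.Hom B₂ (F₀ E₁)) → E.Obj
    γ         : ∀ {B₂} (E₁ : E.Obj) (b : B.Hom B₂ (F₀ E₁)) → E.Hom (liftObj E₁ b) E₁
    γ-over    : ∀ {B₂} (E₁ : E.Obj) (b : B.Hom B₂ (F₀ E₁)) → ArrEq B.Hom (F₁ (γ E₁ b)) b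
    γ-cart    : ∀ {B₂} (E₁ : E.Obj) (b : B.Hom B₂ (F₀ E₁)) → IsCartesian P (γ E₁ b)
    γ-id      : ∀ (X : E.Obj) → ArrEq E.Hom (γ X (B.id {F₀ X})) (E.id {X})
    -- γ(b₂ · b₁ , E₁) = γ(b₂ , E₂) · γ(b₁ , E₁), E₂ the source of γ(b₁,E₁);
    -- b₁ is written as P(γ(b₁,E₁)) so that the composite typechecks
    γ-comp    : ∀ {B₂ B₃} (E₁ : E.Obj) (b₁ : B.Hom B₂ (F₀ E₁))
                (b₂ : B.Hom B₃ (F₀ (liftObj E₁ b₁))) →
                ArrEq E.Hom (γ E₁ (b₂ B.· F₁ (γ E₁ b₁)))
                            (γ (liftObj E₁ b₁) b₂ E.· γ E₁ b₁)
    -- the gap ♭_e : E₂ → Δ(e), Δ(e) = liftObj E₁ (P e), ♯_e = γ E₁ (P e)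
    gap       : ∀ {E₂ E₁} (e : E.Hom E₂ E₁) → E.Hom E₂ (liftObj E₁ (F₁ e))
    gap-over  : ∀ {E₂ E₁} (e : E.Hom E₂ E₁) → ArrEq B.Hom (F₁ (gap e)) (B.id {F₀ E₂})
    gap-fact  : ∀ {E₂ E₁} (e : E.Hom E₂ E₁) → gap e E.· γ E₁ (F₁ e) ≡ e
    faithful  : Faithful P
    replete   : Replete P
    preservesLimits : PreservesLimits P jo jh
    cart-Δ    : ∀ {E₂ E₁} (e : E.Hom E₂ E₁) → IsCartesian P e →
                (liftObj E₁ (F₁ e) ≡ E₂) ×
                ArrEq E.Hom (gap e) (E.id {E₂}) × ArrEq E.Hom (γ E₁ (F₁ e)) e
    cart-cancel : ∀ {E₃ E₂ E₁} (e : E.Hom E₂ E₁) → IsCartesian P e →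
                  (g k : E.Hom E₃ E₂) → g E.· e E.≤ k E.· e → g E.≤ k
    gap-cancel  : ∀ {E₂ E₁ X} (e : E.Hom E₂ E₁)
                  (g k : E.Hom (liftObj E₁ (F₁ e)) X) →
                  gap e E.· g E.≤ gap e E.· k → g E.≤ k
    ≣-lift      : ∀ {E₂ E₁} (f g : E.Hom E₂ E₁) → f E.≣ g →
                  Σ (liftObj E₁ (F₁ f) ≡ liftObj E₁ (F₁ g)) λ p →
                    (subst (λ X → E.Hom E₂ X) p (gap f) ≡ gap g) ×
                    (subst (λ X → E.Hom X E₁) p (γ E₁ (F₁ f)) E.≣ γ E₁ (F₁ g))

-- Both right adjoints of reflections and left adjoints of coreflections are
-- split monomorphisms: ĝ · ǧ = 1 resp. ǧ · ĝ = 1. A split monomorphism e with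
-- retraction s is cartesian for any faithful functor: the lift of v along x is
-- v · s, which lies over x because P preserves e · s = 1, factors v because P is
-- faithful, and is unique because e can be cancelled by composing with s.
module Submission where

open import Level using (Level)
open import Data.Product using (_×_; _,_)
open import Relation.Binary.PropositionalEquality
open import Defs

module _ {o h r o' h' r' : Level} {E : OrderCat o h r} {B : OrderCat o' h' r'}
         (P : OEFunctor E B) where
  private
    module E = OrderCat E
    module B = OrderCat B
  open OEFunctor P
  open ≡-Reasoning

  F-retraction : ∀ {X Y} (e : E.Hom X Y) (s : E.Hom Y X) →
                 e E.· s ≡ E.id → F₁ e B.· F₁ s ≡ B.id
  F-retraction e s es = begin
    F₁ e B.· F₁ s ≡⟨ sym (F-comp e s) ⟩
    F₁ (e E.· s)  ≡⟨ cong F₁ es ⟩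
    F₁ E.id       ≡⟨ F-id ⟩
    B.id          ∎

  retraction-cancelʳ : ∀ {X Y Z} (e : E.Hom X Y) (s : E.Hom Y X) →
                       e E.· s ≡ E.id → (u : E.Hom Z X) → u ≡ (u E.· e) E.· s
  retraction-cancelʳ e s es u = begin
    u                ≡⟨ sym (E.idʳ u) ⟩
    u E.· E.id       ≡⟨ cong (u E.·_) (sym es) ⟩
    u E.· (e E.· s)  ≡⟨ sym (E.assoc u e s) ⟩
    (u E.· e) E.· s  ∎

  splitMono⇒cartesian : Faithful P → ∀ {E₂ E₁} (e : E.Hom E₂ E₁) (s : E.Hom E₁ E₂) →
                        e E.· s ≡ E.id → IsCartesian P e
  splitMono⇒cartesian faithful e s es {X} v x x·Pe≡Pv =
    v E.· s , (factors , over) , unique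
    where
    over : F₁ (v E.· s) ≡ x
    over = begin
      F₁ (v E.· s)           ≡⟨ F-comp v s ⟩
      F₁ v B.· F₁ s          ≡⟨ cong (B._· F₁ s) (sym x·Pe≡Pv) ⟩
      (x B.· F₁ e) B.· F₁ s  ≡⟨ B.assoc x (F₁ e) (F₁ s) ⟩
      x B.· (F₁ e B.· F₁ s)  ≡⟨ cong (x B.·_) (F-retraction e s es) ⟩
      x B.· B.id             ≡⟨ B.idʳ x ⟩
      x                      ∎

    factors : (v E.· s) E.· e ≡ v
    factors = faithful _ _ (begin
      F₁ ((v E.· s) E.· e)   ≡⟨ F-comp (v E.· s) e ⟩
      F₁ (v E.· s) B.· F₁ e  ≡⟨ cong (B._· F₁ e) over ⟩
      x B.· F₁ e             ≡⟨ x·Pe≡Pv ⟩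
      F₁ v                   ∎)

    unique : ∀ (u : E.Hom X _) → (u E.· e ≡ v) × (F₁ u ≡ x) → u ≡ v E.· s
    unique u (u·e≡v , _) =
      trans (retraction-cancelʳ e s es u) (cong (E._· s) u·e≡v)

mainTheorem2 : ∀ {o h r o' h' r' jo jh : Level}
    {E : OrderCat o h r} {B : OrderCat o' h' r'}
    (𝔽 : OEFibration jo jh E B) →
    (∀ {A₀ A₁} (g : OrderCat.Adjunction E A₀ A₁) →
       OrderCat.IsReflection E g →
       IsCartesian (OEFibration.P 𝔽) (OrderCat.Adjunction.right g))
    ×
    (∀ {A₀ A₁} (g : OrderCat.Adjunction E A₀ A₁) →
       OrderCat.IsCoreflection E g →
       IsCartesian (OEFibration.P 𝔽) (OrderCat.Adjunction.left g))
mainTheorem2 𝔽 =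
  (λ g reflection → splitMono⇒cartesian P faithful (right g) (left g) reflection) ,
  (λ g coreflection → splitMono⇒cartesian P faithful (left g) (right g) coreflection)
  where
  open OEFibration 𝔽 using (P; faithful)
  open OrderCat.Adjunction
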